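{- Let $\mathbb{S}$ and $\mathbb{T}$ be algebraic theories such that: (S1) for all $\mathbb S$-terms $s',s''$: if $\emptyset\vdash s'$ and $\Gamma\vdash s'=_{\mathbb S}s''$ then $\emptyset\vdash s''$; (S2) for every $\mathbb S$-term $s'$ and variable $x$: if $\Gamma\vdash s'=_{\mathbb S}x$ then $\{x\}\vdash s'$; (S4) for every $\mathbb S$-term $s'$ with at least one variable there is a substitution $f$ from $\mathrm{var}(s')$ to $\mathbb S$-terms such that for every $x\in\mathrm{var}(s')$, $s'[f(y)/y\neq x]=_{\mathbb S}x$; (T2) for all $\mathbb T$-terms $t',t''$: if $\emptyset\vdash t'$ and $\Gamma\vdash t'=_{\mathbb T}t''$ then $\emptyset\vdash t''$; (T3) for every $\mathbb T$-term $t'$ and variable $x$: if $\Gamma\vdash t'=_{\mathbb T}x$ then $\{x\}\vdash t'$; (T4) $\mathbb T$ has a constant $e_{\mathbb T}$. Suppose there are terms $2\vdash_{\mathbb S}s$ and $2\vdash_{\mathbb T}t$ and constants $e_s$ of $\mathbb S$ and $e_t$ of $\mathbb T$ such that $s(x,e_s)=_{\mathbb S}x=_{\mathbb S}s(e_s,x)$, $s(x,x)=_{\mathbb S}x$, and $t(x,e_t)=_{\mathbb T}x=_{\mathbb T}t(e_t,x)$. Then there exists no composite theory of $\mathbb T$ after $\mathbb S$.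
   Context: An algebraic theory consists of a signature and equations; $=_{\mathbb T}$ is provable equality. $\mathrm{var}(t)$ is the set of variables of $t$; $Y\vdash t$ means $\mathrm{var}(t)\subseteq Y$; $\Gamma$ is an arbitrary context; a constant is a $0$-ary operation. $s'[f(y)/y\neq x]$ substitutes $f(y)$ for every variable $y\neq x$ of $s'$. For theories $\mathbb{S},\mathbb{T}$: $\mathbb{U}$ contains them if its signature contains both signatures and their equations are provable in $\mathbb{U}$; a separated term is $t[s_x/x]$ (simultaneous substitution) with $t$ a $\mathbb{T}$-term with variables in $X$ and $s_x$ $\mathbb{S}$-terms; separated terms $t[s_x/x]$, $t'[s'_{x'}/x']$ are equal modulo $(\mathbb{T},\mathbb{S})$ if there are $f:X\to Y$, $f':X'\to Y$ and $\mathbb{S}$-terms $\bar s_y$ with $t[f(x)/x]=_{\mathbb T}t'[f'(x')/x']$, $s_x=_{\mathbb S}\bar s_{f(x)}$, $s'_{x'}=_{\mathbb S}\bar s_{f'(x')}$; $\mathbb{U}$ is a composite theory of $\mathbb{T}$ after $\mathbb{S}$ if every $\mathbb U$-term is $\mathbb U$-equal to a separated term and any two separated terms $\mathbb U$-equal to a common term are equal modulo $(\mathbb{T},\mathbb{S})$. -}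

module Defs where

open import Data.Nat using (ℕ; _≟_)
open import Data.Fin using (Fin)
open import Data.Empty using (⊥; ⊥-elim)
open import Data.Product using (Σ; _×_; ∃)
open import Relation.Nullary using (¬_; does)
open import Relation.Binary.PropositionalEquality using (_≡_; subst)
open import Data.Bool using (if_then_else_)
open import Function using (_∘_; Injective)

record Signature : Set₁ where
  field
    Op    : Set
    arity : Op → ℕ
open Signature public

data Term (Σ' : Signature) (V : Set) : Set where
  var : V → Term Σ' V
  op  : (o : Op Σ') → (Fin (arity Σ' o) → Term Σ' V) → Term Σ' V

infixl 30 _⟪_⟫
_⟪_⟫ : ∀ {Σ' A B} → Term Σ' A → (A → Term Σ' B) → Term Σ' B
var x    ⟪ σ ⟫ = σ x
op o ts  ⟪ σ ⟫ = op o (λ i → ts i ⟪ σ ⟫)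

rename : ∀ {Σ' A B} → (A → B) → Term Σ' A → Term Σ' B
rename f t = t ⟪ var ∘ f ⟫

fin0-elim : {A : Set} → Fin 0 → A
fin0-elim ()

const : ∀ {Σ' V} (c : Op Σ') → arity Σ' c ≡ 0 → Term Σ' V
const {Σ'} c eq = op c (λ i → fin0-elim (subst Fin eq i))

infix 4 _∈var_
data _∈var_ {Σ' : Signature} (x : ℕ) : Term Σ' ℕ → Set where
  here  : x ∈var var x
  there : ∀ {o ts} (i : Fin (arity Σ' o)) → x ∈var ts i → x ∈var op o ts

infix 4 _⊢_
_⊢_ : ∀ {Σ'} → (ℕ → Set) → Term Σ' ℕ → Set
Y ⊢ t = ∀ y → y ∈var t → Y y

∅ : ℕ → Set
∅ _ = ⊥

｛_｝ : ℕ → ℕ → Set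
｛ x ｝ y = y ≡ x

substExcept : ∀ {Σ'} → ℕ → (ℕ → Term Σ' ℕ) → Term Σ' ℕ → Term Σ' ℕ
substExcept x f s = s ⟪ (λ y → if does (y ≟ x) then var y else f y) ⟫

record Theory : Set₁ where
  field
    sig : Signature
    Ax  : Set
    lhs : Ax → Term sig ℕ
    rhs : Ax → Term sig ℕ
open Theory public

infix 4 _⊢_≈_
data _⊢_≈_ (T : Theory) : Term (sig T) ℕ → Term (sig T) ℕ → Set where
  ≈-refl  : ∀ {u} → T ⊢ u ≈ u
  ≈-sym   : ∀ {u v} → T ⊢ u ≈ v → T ⊢ v ≈ u
  ≈-trans : ∀ {u v w} → T ⊢ u ≈ v → T ⊢ v ≈ w → T ⊢ u ≈ w
  ≈-cong  : ∀ (o : Op (sig T)) {us vs} → (∀ i → T ⊢ us i ≈ vs i) →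
            T ⊢ op o us ≈ op o vs
  ≈-ax    : ∀ (a : Ax T) (σ : ℕ → Term (sig T) ℕ) →
            T ⊢ lhs T a ⟪ σ ⟫ ≈ rhs T a ⟪ σ ⟫

record SigIncl (Σ₁ Σ₂ : Signature) : Set where
  field
    map      : Op Σ₁ → Op Σ₂
    arity-eq : ∀ o → arity Σ₂ (map o) ≡ arity Σ₁ o
    map-inj  : Injective _≡_ _≡_ map
open SigIncl public

translate : ∀ {Σ₁ Σ₂ V} → SigIncl Σ₁ Σ₂ → Term Σ₁ V → Term Σ₂ V
translate ι (var x)   = var x
translate ι (op o ts) =
  op (map ι o) (λ i → translate ι (ts (subst Fin (arity-eq ι o) i)))

-- Separated terms t[s_x/x]: t a T-term with variables in X = Fin n,
-- s_x S-terms (one for each x ∈ X).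

record Separated (T S : Theory) : Set where
  field
    n  : ℕ
    tT : Term (sig T) (Fin n)
    sS : Fin n → Term (sig S) ℕ
open Separated public

EqMod : ∀ {T S} → Separated T S → Separated T S → Set
EqMod {T} {S} σ σ' =
  Σ (Fin (n σ) → ℕ) λ f →
  Σ (Fin (n σ') → ℕ) λ f' →
  Σ (ℕ → Term (sig S) ℕ) λ s̄ →
    (T ⊢ rename f (tT σ) ≈ rename f' (tT σ'))
  × (∀ x → S ⊢ sS σ x ≈ s̄ (f x))
  × (∀ x' → S ⊢ sS σ' x' ≈ s̄ (f' x'))

record CompositeTheory (T S : Theory) : Set₁ where
  field
    U    : Theory
    ιS   : SigIncl (sig S) (sig U)
    ιT   : SigIncl (sig T) (sig U)
    S-eqs : ∀ a → U ⊢ translate ιS (lhs S a) ≈ translate ιS (rhs S a)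
    T-eqs : ∀ a → U ⊢ translate ιT (lhs T a) ≈ translate ιT (rhs T a)

  ⟦_⟧ : Separated T S → Term (sig U) ℕ
  ⟦ σ ⟧ = translate ιT (tT σ) ⟪ (λ x → translate ιS (sS σ x)) ⟫

  field
    separation : ∀ (u : Term (sig U) ℕ) →
                 Σ (Separated T S) λ σ → U ⊢ u ≈ ⟦ σ ⟧
    uniqueness : ∀ (σ σ' : Separated T S) (u : Term (sig U) ℕ) →
                 U ⊢ ⟦ σ ⟧ ≈ u → U ⊢ ⟦ σ' ⟧ ≈ u → EqMod σ σ'

infixl 30 _⟨_,_⟩
_⟨_,_⟩ : ∀ {Σ' V} → Term Σ' (Fin 2) → Term Σ' V → Term Σ' V → Term Σ' V
u ⟨ a , b ⟩ = u ⟪ pick ⟫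
  where
  pick : Fin 2 → _
  pick Fin.zero    = a
  pick (Fin.suc _) = b

-- Let D = s(t(x₀,x₁), t(x₂,x₃)) and take a separated form of D: a T-skeleton with S-leaves.
-- Identifying x₂ with x₀ and x₃ with x₁ turns D into t(x₀,x₁) (idempotence of s), so by
-- uniqueness every leaf occurring in the skeleton then becomes S-equal to x₀ or x₁.
-- Substituting e_T for x₁ and x₂ turns D into s(x₀,x₃) (units of t); leaves containing x₁ or x₂
-- collapse to e_T by (S4) and (T2), the others are unchanged, so by uniqueness some occurring
-- leaf is S-equal to s(x₀,x₃). After the identification that leaf is s(x₀,x₁), which the unit
-- e_S prevents from being S-equal to a variable.
module Submission where

open import Defs
open import Data.Nat using (ℕ; zero; suc; _≟_)
open import Data.Fin using (Fin; toℕ; zero; suc)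
open import Data.Fin.Properties using (any?)
open import Data.Bool using (Bool; true; false; if_then_else_)
open import Data.Bool.Properties using (¬-not) renaming (_≟_ to _≟ᵇ_)
open import Data.Product using (Σ; ∃; _×_; _,_; proj₁; uncurry)
open import Data.Sum using (_⊎_; inj₁; inj₂; [_,_]′)
import Data.Sum as Sum
open import Data.Empty using (⊥; ⊥-elim)
open import Function using (_∘_)
open import Relation.Nullary using (¬_; Dec; yes; no; does)
open import Relation.Nullary.Decidable using (map′; dec-true; dec-false)
open import Relation.Binary.PropositionalEquality using (_≡_; refl; sym; subst)
open import Relation.Binary.Bundles using (Setoid)
import Relation.Binary.Reasoning.Setoid as SetoidReasoning

module _ {X : Theory} where

  ≈-reflexive : ∀ {u v} → u ≡ v → X ⊢ u ≈ v
  ≈-reflexive refl = ≈-refl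

  ⟪⟫-assoc : ∀ {A B} (a : Term (sig X) A) (θ : A → Term (sig X) B) (τ : B → Term (sig X) ℕ) →
             X ⊢ a ⟪ θ ⟫ ⟪ τ ⟫ ≈ a ⟪ (λ x → θ x ⟪ τ ⟫) ⟫
  ⟪⟫-assoc (var x)   θ τ = ≈-refl
  ⟪⟫-assoc (op o ts) θ τ = ≈-cong o (λ i → ⟪⟫-assoc (ts i) θ τ)

  ⟪⟫-congʳ : ∀ {A} (a : Term (sig X) A) {θ θ' : A → Term (sig X) ℕ} →
             (∀ x → X ⊢ θ x ≈ θ' x) → X ⊢ a ⟪ θ ⟫ ≈ a ⟪ θ' ⟫
  ⟪⟫-congʳ (var x)   θ≈θ' = θ≈θ' x
  ⟪⟫-congʳ (op o ts) θ≈θ' = ≈-cong o (λ i → ⟪⟫-congʳ (ts i) θ≈θ')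

  ⟪⟫-congˡ : ∀ {u v} → X ⊢ u ≈ v → (τ : ℕ → Term (sig X) ℕ) → X ⊢ u ⟪ τ ⟫ ≈ v ⟪ τ ⟫
  ⟪⟫-congˡ ≈-refl          τ = ≈-refl
  ⟪⟫-congˡ (≈-sym p)       τ = ≈-sym (⟪⟫-congˡ p τ)
  ⟪⟫-congˡ (≈-trans p q)   τ = ≈-trans (⟪⟫-congˡ p τ) (⟪⟫-congˡ q τ)
  ⟪⟫-congˡ (≈-cong o ps)   τ = ≈-cong o (λ i → ⟪⟫-congˡ (ps i) τ)
  ⟪⟫-congˡ (≈-ax a σ)      τ =
    ≈-trans (⟪⟫-assoc (lhs X a) σ τ) (≈-trans (≈-ax a _) (≈-sym (⟪⟫-assoc (rhs X a) σ τ)))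

  ⟪⟫-identity : (u : Term (sig X) ℕ) {θ : ℕ → Term (sig X) ℕ} →
                (∀ z → z ∈var u → θ z ≡ var z) → X ⊢ u ⟪ θ ⟫ ≈ u
  ⟪⟫-identity (var x)   θ-id = ≈-reflexive (θ-id x here)
  ⟪⟫-identity (op o ts) θ-id = ≈-cong o (λ i → ⟪⟫-identity (ts i) (λ z p → θ-id z (there i p)))

  ⟨,⟩-⟪⟫ : (w : Term (sig X) (Fin 2)) (a b : Term (sig X) ℕ) (τ : ℕ → Term (sig X) ℕ) →
           X ⊢ w ⟨ a , b ⟩ ⟪ τ ⟫ ≈ w ⟨ a ⟪ τ ⟫ , b ⟪ τ ⟫ ⟩
  ⟨,⟩-⟪⟫ w a b τ = ≈-trans (⟪⟫-assoc w _ τ)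
    (⟪⟫-congʳ w λ { zero → ≈-refl ; (suc zero) → ≈-refl })

  ⟨,⟩-cong : (w : Term (sig X) (Fin 2)) {a a' b b' : Term (sig X) ℕ} →
             X ⊢ a ≈ a' → X ⊢ b ≈ b' → X ⊢ w ⟨ a , b ⟩ ≈ w ⟨ a' , b' ⟩
  ⟨,⟩-cong w a≈a' b≈b' = ⟪⟫-congʳ w λ { zero → a≈a' ; (suc zero) → b≈b' }

  nullary-cong : (c : Op (sig X)) → (Fin (arity (sig X) c) → ⊥) →
                 (us vs : Fin (arity (sig X) c) → Term (sig X) ℕ) → X ⊢ op c us ≈ op c vs
  nullary-cong c empty us vs = ≈-cong c (λ i → ⊥-elim (empty i))

≈-setoid : Theory → Setoid _ _
≈-setoid X = record
  { Carrier       = Term (sig X) ℕ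
  ; _≈_           = X ⊢_≈_
  ; isEquivalence = record { refl = ≈-refl ; sym = ≈-sym ; trans = ≈-trans }
  }

module ≈-Reasoning (X : Theory) = SetoidReasoning (≈-setoid X)

module _ {Σ' : Signature} where

  ∈var-⟪⟫ : ∀ {y z} (u : Term Σ' ℕ) (θ : ℕ → Term Σ' ℕ) → y ∈var u → z ∈var θ y → z ∈var u ⟪ θ ⟫
  ∈var-⟪⟫ (var x)   θ here        z∈ = z∈
  ∈var-⟪⟫ (op o ts) θ (there i p) z∈ = there i (∈var-⟪⟫ (ts i) θ p z∈)

  ∈var-⟪⟫⁻ : ∀ {z} (u : Term Σ' ℕ) (θ : ℕ → Term Σ' ℕ) → z ∈var u ⟪ θ ⟫ →
             ∃ λ y → y ∈var u × z ∈var θ y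
  ∈var-⟪⟫⁻ (var x)   θ z∈          = x , here , z∈
  ∈var-⟪⟫⁻ (op o ts) θ (there i z∈) with ∈var-⟪⟫⁻ (ts i) θ z∈
  ... | y , y∈ , z∈θy = y , there i y∈ , z∈θy

  -- Occurrences in u are observed through the renaming g, since ∈var only speaks about ℕ-terms.
  ∈var-⟪⟫-⟪⟫⁻ : ∀ {A B z} (u : Term Σ' A) (ζ : A → Term Σ' B) (τ : B → Term Σ' ℕ) (g : A → ℕ) →
                z ∈var u ⟪ ζ ⟫ ⟪ τ ⟫ → ∃ λ a → g a ∈var rename g u × z ∈var ζ a ⟪ τ ⟫
  ∈var-⟪⟫-⟪⟫⁻ (var a)   ζ τ g z∈           = a , here , z∈
  ∈var-⟪⟫-⟪⟫⁻ (op o ts) ζ τ g (there i z∈) with ∈var-⟪⟫-⟪⟫⁻ (ts i) ζ τ g z∈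
  ... | a , a∈ , z∈ζa = a , there i a∈ , z∈ζa

  ∃var? : (b : ℕ → Bool) (u : Term Σ' ℕ) → Dec (∃ λ z → z ∈var u × b z ≡ true)
  ∃var? b (var x)   = map′ (λ bx → x , here , bx) (λ { (_ , here , bx) → bx }) (b x ≟ᵇ true)
  ∃var? b (op o ts) = map′ (λ { (i , z , z∈ , bz) → z , there i z∈ , bz })
                           (λ { (z , there i z∈ , bz) → i , z , z∈ , bz })
                           (any? (λ i → ∃var? b (ts i)))

  nullary-closed : ∀ {c : Op Σ'} {us : Fin (arity Σ' c) → Term Σ' ℕ} → arity Σ' c ≡ 0 →
                   _⊢_ {Σ'} ∅ (op c us)
  nullary-closed c0 y (there i _) = fin0-elim (subst Fin c0 i)

ClosedRigid : Theory → Set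
ClosedRigid X = ∀ (u v : Term (sig X) ℕ) → ∅ ⊢ u → X ⊢ u ≈ v → ∅ ⊢ v

VariableRigid : Theory → Set
VariableRigid X = ∀ (u : Term (sig X) ℕ) (x : ℕ) → X ⊢ u ≈ var x → ｛ x ｝ ⊢ u

VariablesIsolable : Theory → Set
VariablesIsolable X = ∀ (u : Term (sig X) ℕ) → (∃ λ x → x ∈var u) →
  Σ (ℕ → Term (sig X) ℕ) λ f → ∀ x → x ∈var u → X ⊢ substExcept x f u ≈ var x

module _ {X : Theory} where

  var≉closed : ClosedRigid X → ∀ {x e} → ∅ ⊢ e → ¬ X ⊢ var x ≈ e
  var≉closed rigid {x} e-closed x≈e = rigid _ _ e-closed (≈-sym x≈e) x here

  var-occurs : ClosedRigid X → VariableRigid X → ∀ {u x} → X ⊢ u ≈ var x → x ∈var u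
  var-occurs closedRigid varRigid {u} {x} u≈x with ∃var? (λ _ → true) u
  ... | yes (z , z∈ , _) = subst (_∈var u) (varRigid u x u≈x z z∈) z∈
  ... | no  no-var       = ⊥-elim (var≉closed closedRigid (λ z z∈ → no-var (z , z∈ , refl)) (≈-sym u≈x))

  sole-variable : VariablesIsolable X → ∀ {u x} → x ∈var u → (∀ z → z ∈var u → z ≡ x) → X ⊢ u ≈ var x
  sole-variable isolable {u} {x} x∈ only-x with isolable u (x , x∈)
  ... | f , isolated = ≈-trans (≈-sym (⟪⟫-identity u fixes)) (isolated x x∈)
    where
    fixes : ∀ z → z ∈var u → (if does (z ≟ x) then var z else f z) ≡ var z
    fixes z z∈ rewrite only-x z z∈ | dec-true (x ≟ x) refl = refl

  unitˡ⇒≉x₀ : ClosedRigid X → ∀ {w : Term (sig X) (Fin 2)} {e} → ∅ ⊢ e →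
              X ⊢ w ⟨ e , var 1 ⟩ ≈ var 1 → ¬ X ⊢ w ⟨ var 0 , var 1 ⟩ ≈ var 0
  unitˡ⇒≉x₀ rigid {w} {e} e-closed unit w≈x₀ =
    var≉closed rigid e-closed (≈-trans (≈-sym unit) (≈-trans (≈-sym (⟨,⟩-⟪⟫ w _ _ τ)) (⟪⟫-congˡ w≈x₀ τ)))
    where
    τ : ℕ → Term (sig X) ℕ
    τ zero = e
    τ n    = var n

  unitʳ⇒≉x₁ : ClosedRigid X → ∀ {w : Term (sig X) (Fin 2)} {e} → ∅ ⊢ e →
              X ⊢ w ⟨ var 0 , e ⟩ ≈ var 0 → ¬ X ⊢ w ⟨ var 0 , var 1 ⟩ ≈ var 1
  unitʳ⇒≉x₁ rigid {w} {e} e-closed unit w≈x₁ =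
    var≉closed rigid e-closed (≈-trans (≈-sym unit) (≈-trans (≈-sym (⟨,⟩-⟪⟫ w _ _ τ)) (⟪⟫-congˡ w≈x₁ τ)))
    where
    τ : ℕ → Term (sig X) ℕ
    τ (suc zero) = e
    τ n          = var n

module Translation {X U : Theory} (ι : SigIncl (sig X) (sig U)) where

  private
    tr : ∀ {V} → Term (sig X) V → Term (sig U) V
    tr = translate ι

  translate-⟪⟫ : ∀ {A} (a : Term (sig X) A) (θ : A → Term (sig X) ℕ) →
                 U ⊢ tr (a ⟪ θ ⟫) ≈ tr a ⟪ tr ∘ θ ⟫
  translate-⟪⟫ (var x)   θ = ≈-refl
  translate-⟪⟫ (op o ts) θ = ≈-cong (map ι o) (λ k → translate-⟪⟫ (ts (subst Fin (arity-eq ι o) k)) θ)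

  translate-⟪⟫-⟪⟫ : ∀ {A B} (a : Term (sig X) A) (θ : A → Term (sig X) B) (τ : B → Term (sig U) ℕ) →
                    U ⊢ tr (a ⟪ θ ⟫) ⟪ τ ⟫ ≈ tr a ⟪ (λ x → tr (θ x) ⟪ τ ⟫) ⟫
  translate-⟪⟫-⟪⟫ (var x)   θ τ = ≈-refl
  translate-⟪⟫-⟪⟫ (op o ts) θ τ =
    ≈-cong (map ι o) (λ k → translate-⟪⟫-⟪⟫ (ts (subst Fin (arity-eq ι o) k)) θ τ)

  translate-⟨,⟩ : (w : Term (sig X) (Fin 2)) (a b : Term (sig X) ℕ) →
                  U ⊢ tr (w ⟨ a , b ⟩) ≈ tr w ⟨ tr a , tr b ⟩
  translate-⟨,⟩ w a b = ≈-trans (translate-⟪⟫ w _)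
    (⟪⟫-congʳ (tr w) λ { zero → ≈-refl ; (suc zero) → ≈-refl })

  ∈var-translate : ∀ {y} (r : Term (sig X) ℕ) → y ∈var tr r → y ∈var r
  ∈var-translate (var x)   here        = here
  ∈var-translate (op o ts) (there k p) = there (subst Fin (arity-eq ι o) k) (∈var-translate (ts _) p)

  translate-nullary-cong : ∀ {c} → arity (sig X) c ≡ 0 →
                           (us vs : Fin (arity (sig U) (map ι c)) → Term (sig U) ℕ) →
                           U ⊢ op (map ι c) us ≈ op (map ι c) vs
  translate-nullary-cong {c} c0 =
    nullary-cong (map ι c) (λ k → fin0-elim (subst Fin c0 (subst Fin (arity-eq ι c) k)))

  translate-closed-⟪⟫ : ∀ {m} (u : Term (sig X) (Fin m)) (f : Fin m → ℕ) → ∅ ⊢ rename f u →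
                        (θ θ' : Fin m → Term (sig U) ℕ) → U ⊢ tr u ⟪ θ ⟫ ≈ tr u ⟪ θ' ⟫
  translate-closed-⟪⟫ (var i)   f closed θ θ' = ⊥-elim (closed (f i) here)
  translate-closed-⟪⟫ (op o ts) f closed θ θ' = ≈-cong (map ι o) λ k →
    translate-closed-⟪⟫ (ts (subst Fin (arity-eq ι o) k)) f (λ y p → closed y (there _ p)) θ θ'

  module _ (eqs : ∀ a → U ⊢ tr (lhs X a) ≈ tr (rhs X a)) where

    translate-≈ : ∀ {u v} → X ⊢ u ≈ v → U ⊢ tr u ≈ tr v
    translate-≈ ≈-refl        = ≈-refl
    translate-≈ (≈-sym p)     = ≈-sym (translate-≈ p)
    translate-≈ (≈-trans p q) = ≈-trans (translate-≈ p) (translate-≈ q)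
    translate-≈ (≈-cong o ps) = ≈-cong (map ι o) (λ k → translate-≈ (ps (subst Fin (arity-eq ι o) k)))
    translate-≈ (≈-ax a σ)    = ≈-trans (translate-⟪⟫ (lhs X a) σ)
      (≈-trans (⟪⟫-congˡ (eqs a) (tr ∘ σ)) (≈-sym (translate-⟪⟫ (rhs X a) σ)))

    translate-law : (w : Term (sig X) (Fin 2)) {a b c : Term (sig X) ℕ} → X ⊢ w ⟨ a , b ⟩ ≈ c →
                    (τ : ℕ → Term (sig U) ℕ) → U ⊢ tr w ⟨ tr a ⟪ τ ⟫ , tr b ⟪ τ ⟫ ⟩ ≈ tr c ⟪ τ ⟫
    translate-law w {a} {b} law τ = ≈-trans (≈-sym (⟨,⟩-⟪⟫ (tr w) (tr a) (tr b) τ))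
      (≈-trans (⟪⟫-congˡ (≈-sym (translate-⟨,⟩ w a b)) τ) (⟪⟫-congˡ (translate-≈ law) τ))

module _ {T S : Theory} where

  substLeaves : (ℕ → Term (sig S) ℕ) → Separated T S → Separated T S
  substLeaves g σ = record { n = n σ ; tT = tT σ ; sS = λ i → sS σ i ⟪ g ⟫ }

  binarySep : Term (sig T) (Fin 2) → Separated T S
  binarySep t = record { n = 2 ; tT = t ; sS = var ∘ toℕ }

  leafSep : Term (sig S) ℕ → Separated T S
  leafSep l = record { n = 1 ; tT = var zero ; sS = λ _ → l }

  EqMod-binary⇒leaf≈x₀⊎x₁ :
    VariableRigid S → VariableRigid T →
    ∀ {t et} (et0 : arity (sig T) et ≡ 0) → (∀ x → T ⊢ t ⟨ var x , const et et0 ⟩ ≈ var x) →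
    (σ : Separated T S) (m : EqMod σ (binarySep t)) (j : Fin (n σ)) →
    proj₁ m j ∈var rename (proj₁ m) (tT σ) → S ⊢ sS σ j ≈ var 0 ⊎ S ⊢ sS σ j ≈ var 1
  EqMod-binary⇒leaf≈x₀⊎x₁ varRigidS varRigidT {t} {et} et0 unitʳ σ (g , g' , s̄ , t≈ , leaf≈ , x≈) j g-j∈ =
    Sum.map (leaf≈x zero) (leaf≈x (suc zero)) g-j≡a⊎b
    where
    a b : ℕ
    a = g' zero
    b = g' (suc zero)

    leaf≈x : ∀ k → g j ≡ g' k → S ⊢ sS σ j ≈ var (toℕ k)
    leaf≈x k g-j≡ = ≈-trans (leaf≈ j) (subst (λ y → S ⊢ s̄ y ≈ var (toℕ k)) (sym g-j≡) (≈-sym (x≈ k)))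

    a≢b : ¬ a ≡ b
    a≢b a≡b with varRigidS _ 0 (≈-trans (x≈ (suc zero)) (subst (λ y → S ⊢ s̄ y ≈ var 0) a≡b (≈-sym (x≈ zero)))) 1 here
    ... | ()

    β : ℕ → Term (sig T) ℕ
    β y = if does (y ≟ b) then const et et0 else var y

    β-other : ∀ {y} → ¬ y ≡ b → β y ≡ var y
    β-other {y} y≢b rewrite dec-false (y ≟ b) y≢b = refl

    β-b : β b ≡ const et et0
    β-b rewrite dec-true (b ≟ b) refl = refl

    -- Sending x_b to e_T reduces the skeleton to x_a (right unit of t), so by (T3) it mentions only a and b.
    skeleton-β≈a : T ⊢ rename g (tT σ) ⟪ β ⟫ ≈ var a
    skeleton-β≈a = ≈-trans (⟪⟫-congˡ t≈ β) (≈-trans (⟪⟫-assoc t _ β) (≈-trans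
      (⟪⟫-congʳ t λ { zero → ≈-reflexive (β-other a≢b) ; (suc zero) → ≈-reflexive β-b })
      (unitʳ a)))

    g-j≡a⊎b : g j ≡ a ⊎ g j ≡ b
    g-j≡a⊎b with g j ≟ b
    ... | yes g-j≡b = inj₂ g-j≡b
    ... | no  g-j≢b = inj₁ (varRigidT _ a skeleton-β≈a (g j)
            (∈var-⟪⟫ (rename g (tT σ)) β g-j∈ (subst (g j ∈var_) (sym (β-other g-j≢b)) here)))

  EqMod-leaf⇒occurring-leaf≈ :
    ClosedRigid T → VariableRigid T →
    ∀ {N et} (et0 : arity (sig T) et ≡ 0) (u : Term (sig T) (Fin N)) (ζ : Fin N → Term (sig T) (Fin N)) →
    (∀ i → ζ i ≡ var i ⊎ ζ i ≡ const et et0) →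
    (ls : Fin N → Term (sig S) ℕ) (l : Term (sig S) ℕ) →
    EqMod (record { n = N ; tT = u ⟪ ζ ⟫ ; sS = ls }) (leafSep l) →
    (g : Fin N → ℕ) → ∃ λ j → g j ∈var rename g u × S ⊢ ls j ≈ l
  EqMod-leaf⇒occurring-leaf≈ closedRigid varRigid {N} {et} et0 u ζ ζ-erases ls l
                             (h , h' , s̃ , t≈ , leaf≈ , l≈) g
    with ∈var-⟪⟫-⟪⟫⁻ u ζ (var ∘ h) g (var-occurs closedRigid varRigid t≈)
  ... | j , g-j∈ , h'₀∈ =
    j , g-j∈ , ≈-trans (leaf≈ j) (subst (λ y → S ⊢ s̃ y ≈ l) (erased-var (ζ j) (ζ-erases j) h'₀∈) (≈-sym (l≈ zero)))
    where
    erased-var : ∀ {z j} (v : Term (sig T) (Fin N)) → v ≡ var j ⊎ v ≡ const et et0 →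
                 z ∈var v ⟪ var ∘ h ⟫ → z ≡ h j
    erased-var _ (inj₁ refl) here        = refl
    erased-var _ (inj₂ refl) (there k _) = fin0-elim (subst Fin et0 k)

module Composite {S T : Theory} (C : CompositeTheory T S) (closedRigidT : ClosedRigid T)
                 (isolableS : VariablesIsolable S)
                 (es : Op (sig S)) (es0 : arity (sig S) es ≡ 0)
                 (et : Op (sig T)) (et0 : arity (sig T) et ≡ 0) where

  open CompositeTheory C public
  open ≈-Reasoning U
  module TrS = Translation {S} {U} ιS
  module TrT = Translation {T} {U} ιT

  trS : Term (sig S) ℕ → Term (sig U) ℕ
  trS = translate ιS

  eS : Term (sig S) ℕ
  eS = const es es0

  eT : ∀ {V} → Term (sig T) V
  eT = const et et0

  eU : Term (sig U) ℕ
  eU = translate ιT eT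

  eU-cong : (us vs : Fin (arity (sig U) (map ιT et)) → Term (sig U) ℕ) →
            U ⊢ op (map ιT et) us ≈ op (map ιT et) vs
  eU-cong = TrT.translate-nullary-cong et0

  κ : (ℕ → Bool) → ℕ → Term (sig U) ℕ
  κ b y = if b y then eU else var y

  κ-true : ∀ {b y} → b y ≡ true → κ b y ≡ eU
  κ-true by rewrite by = refl

  κ-false : ∀ {b y} → b y ≡ false → κ b y ≡ var y
  κ-false by rewrite by = refl

  ⟦⟧-⟪⟫ : (σ : Separated T S) (g : ℕ → Term (sig S) ℕ) → U ⊢ ⟦ σ ⟧ ⟪ trS ∘ g ⟫ ≈ ⟦ substLeaves g σ ⟧
  ⟦⟧-⟪⟫ σ g = ≈-trans (⟪⟫-assoc (translate ιT (tT σ)) _ _)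
    (⟪⟫-congʳ (translate ιT (tT σ)) (λ i → ≈-sym (TrS.translate-⟪⟫ (sS σ i) g)))

  eUSep : Separated T S
  eUSep = record { n = 0 ; tT = eT ; sS = λ () }

  -- Uniqueness against the leafless e_T forces the skeleton of ρ to be closed, so ρ ignores its leaves.
  ⟪⟫≈eU⇒≈eU : ∀ ρ (g : ℕ → Term (sig S) ℕ) → U ⊢ ρ ⟪ trS ∘ g ⟫ ≈ eU → U ⊢ ρ ≈ eU
  ⟪⟫≈eU⇒≈eU ρ g ρg≈eU with separation ρ
  ... | σ , ρ≈σ with uniqueness (substLeaves g σ) eUSep eU σg≈eU (eU-cong _ _)
    where
    σg≈eU : U ⊢ ⟦ substLeaves g σ ⟧ ≈ eU
    σg≈eU = ≈-trans (≈-sym (⟦⟧-⟪⟫ σ g)) (≈-trans (⟪⟫-congˡ (≈-sym ρ≈σ) _) ρg≈eU)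
  ... | f , _ , _ , skeleton≈eT , _ = begin
    ρ                                                       ≈⟨ ρ≈σ ⟩
    ⟦ σ ⟧                                                   ≈⟨ TrT.translate-closed-⟪⟫ (tT σ) f skeleton-closed _ _ ⟩
    translate ιT (tT σ) ⟪ (λ i → trS (sS σ i) ⟪ trS ∘ g ⟫) ⟫ ≈⟨ ⟪⟫-assoc (translate ιT (tT σ)) _ (trS ∘ g) ⟨
    ⟦ σ ⟧ ⟪ trS ∘ g ⟫                                       ≈⟨ ⟪⟫-congˡ ρ≈σ _ ⟨
    ρ ⟪ trS ∘ g ⟫                                           ≈⟨ ρg≈eU ⟩
    eU                                                      ∎
    where
    skeleton-closed : ∅ ⊢ rename f (tT σ)
    skeleton-closed = closedRigidT _ _ (nullary-closed et0) (≈-sym skeleton≈eT)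

  -- x stands in for every b-variable and e_S for every other one; by (S4) that turns r into x.
  eU-absorbs : ∀ {b x} (r : Term (sig S) ℕ) → x ∈var r → b x ≡ true → U ⊢ trS r ⟪ κ b ⟫ ≈ eU
  eU-absorbs {b} {x} r x∈ bx = ⟪⟫≈eU⇒≈eU (trS r ⟪ κ b ⟫) (λ _ → eS) (begin
    trS r ⟪ κ b ⟫ ⟪ (λ _ → trS eS) ⟫          ≈⟨ ⟪⟫-assoc (trS r) (κ b) _ ⟩
    trS r ⟪ (λ y → κ b y ⟪ (λ _ → trS eS) ⟫) ⟫ ≈⟨ ⟪⟫-congʳ (trS r) pointwise ⟩
    trS r ⟪ (λ y → trS (ρ y) ⟪ κ b ⟫) ⟫       ≈⟨ TrS.translate-⟪⟫-⟪⟫ r ρ (κ b) ⟨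
    trS (r ⟪ ρ ⟫) ⟪ κ b ⟫                     ≈⟨ ⟪⟫-congˡ (TrS.translate-≈ S-eqs r⟪ρ⟫≈x) (κ b) ⟩
    κ b x                                     ≡⟨ κ-true {b} bx ⟩
    eU                                        ∎)
    where
    ρ : ℕ → Term (sig S) ℕ
    ρ y = if b y then var x else eS

    pointwise : ∀ y → U ⊢ κ b y ⟪ (λ _ → trS eS) ⟫ ≈ trS (ρ y) ⟪ κ b ⟫
    pointwise y with b y
    ... | true  = ≈-trans (eU-cong _ _) (≈-reflexive (sym (κ-true {b} bx)))
    ... | false = TrS.translate-nullary-cong es0 _ _

    only-x : ∀ z → z ∈var r ⟪ ρ ⟫ → z ≡ x
    only-x z z∈ with ∈var-⟪⟫⁻ r ρ z∈
    ... | y , _ , z∈ρy with b y | z∈ρy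
    ...   | true  | here      = refl
    ...   | false | there k _ = fin0-elim (subst Fin es0 k)

    ρ-x : ρ x ≡ var x
    ρ-x rewrite bx = refl

    x∈r⟪ρ⟫ : x ∈var r ⟪ ρ ⟫
    x∈r⟪ρ⟫ = ∈var-⟪⟫ r ρ x∈ (subst (x ∈var_) (sym ρ-x) here)

    r⟪ρ⟫≈x : S ⊢ r ⟪ ρ ⟫ ≈ var x
    r⟪ρ⟫≈x = sole-variable isolableS x∈r⟪ρ⟫ only-x

  erasure : ∀ {N} → (ℕ → Bool) → (Fin N → Term (sig S) ℕ) → Fin N → Term (sig T) (Fin N)
  erasure b ls i with ∃var? b (ls i)
  ... | yes _ = eT
  ... | no  _ = var i

  erasure-erases : ∀ {N} (b : ℕ → Bool) (ls : Fin N → Term (sig S) ℕ) i →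
                   erasure b ls i ≡ var i ⊎ erasure b ls i ≡ eT
  erasure-erases b ls i with ∃var? b (ls i)
  ... | yes _ = inj₂ refl
  ... | no  _ = inj₁ refl

  eraseLeaves : (ℕ → Bool) → Separated T S → Separated T S
  eraseLeaves b σ = record { n = n σ ; tT = tT σ ⟪ erasure b (sS σ) ⟫ ; sS = sS σ }

  ⟦eraseLeaves⟧ : ∀ b σ → U ⊢ ⟦ eraseLeaves b σ ⟧ ≈ ⟦ σ ⟧ ⟪ κ b ⟫
  ⟦eraseLeaves⟧ b σ = begin
    ⟦ eraseLeaves b σ ⟧
      ≈⟨ TrT.translate-⟪⟫-⟪⟫ (tT σ) _ _ ⟩
    translate ιT (tT σ) ⟪ (λ i → translate ιT (erasure b (sS σ) i) ⟪ leaves ⟫) ⟫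
      ≈⟨ ⟪⟫-congʳ (translate ιT (tT σ)) pointwise ⟩
    translate ιT (tT σ) ⟪ (λ i → leaves i ⟪ κ b ⟫) ⟫
      ≈⟨ ⟪⟫-assoc (translate ιT (tT σ)) leaves (κ b) ⟨
    ⟦ σ ⟧ ⟪ κ b ⟫
      ∎
    where
    leaves : Fin (n σ) → Term (sig U) ℕ
    leaves = trS ∘ sS σ

    pointwise : ∀ i → U ⊢ translate ιT (erasure b (sS σ) i) ⟪ leaves ⟫ ≈ leaves i ⟪ κ b ⟫
    pointwise i with ∃var? b (sS σ i)
    ... | yes (x , x∈ , bx) = ≈-trans (eU-cong _ _) (≈-sym (eU-absorbs (sS σ i) x∈ bx))
    ... | no  no-b-var      = ≈-sym (⟪⟫-identity (leaves i) λ z z∈ →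
      κ-false {b} (¬-not λ bz → no-b-var (z , TrS.∈var-translate (sS σ i) z∈ , bz)))

  module Diagonal (s : Term (sig S) (Fin 2)) (t : Term (sig T) (Fin 2))
                  (s-idem : ∀ x → S ⊢ s ⟨ var x , var x ⟩ ≈ var x)
                  (t-unitʳ : ∀ x → T ⊢ t ⟨ var x , eT ⟩ ≈ var x)
                  (t-unitˡ : ∀ x → T ⊢ t ⟨ eT , var x ⟩ ≈ var x) where

    sU tU : Term (sig U) ℕ → Term (sig U) ℕ → Term (sig U) ℕ
    sU a b = translate ιS s ⟨ a , b ⟩
    tU a b = translate ιT t ⟨ a , b ⟩

    sU-idem : ∀ u → U ⊢ sU u u ≈ u
    sU-idem u = TrS.translate-law S-eqs s (s-idem 0) (λ _ → u)

    tU-unitʳ : ∀ u → U ⊢ tU u eU ≈ u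
    tU-unitʳ u = ≈-trans (⟨,⟩-cong (translate ιT t) ≈-refl (eU-cong _ _))
                         (TrT.translate-law T-eqs t (t-unitʳ 0) (λ _ → u))

    tU-unitˡ : ∀ u → U ⊢ tU eU u ≈ u
    tU-unitˡ u = ≈-trans (⟨,⟩-cong (translate ιT t) (eU-cong _ _) ≈-refl)
                         (TrT.translate-law T-eqs t (t-unitˡ 0) (λ _ → u))

    D : Term (sig U) ℕ
    D = sU (tU (var 0) (var 1)) (tU (var 2) (var 3))

    merge : ℕ → ℕ
    merge 2 = 0
    merge 3 = 1
    merge n = n

    middle : ℕ → Bool
    middle 1 = true
    middle 2 = true
    middle _ = false

    D-merge : U ⊢ D ⟪ var ∘ merge ⟫ ≈ tU (var 0) (var 1)
    D-merge = ≈-trans (⟨,⟩-⟪⟫ (translate ιS s) _ _ _)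
      (≈-trans (⟨,⟩-cong (translate ιS s) (⟨,⟩-⟪⟫ (translate ιT t) _ _ _) (⟨,⟩-⟪⟫ (translate ιT t) _ _ _))
               (sU-idem _))

    D-collapse : U ⊢ D ⟪ κ middle ⟫ ≈ sU (var 0) (var 3)
    D-collapse = ≈-trans (⟨,⟩-⟪⟫ (translate ιS s) _ _ _)
      (⟨,⟩-cong (translate ιS s) (≈-trans (⟨,⟩-⟪⟫ (translate ιT t) _ _ _) (tU-unitʳ (var 0)))
                                  (≈-trans (⟨,⟩-⟪⟫ (translate ιT t) _ _ _) (tU-unitˡ (var 3))))

    D-merged : (σ : Separated T S) → U ⊢ D ≈ ⟦ σ ⟧ → EqMod (substLeaves (var ∘ merge) σ) (binarySep t)
    D-merged σ D≈σ = uniqueness (substLeaves (var ∘ merge) σ) (binarySep t) (tU (var 0) (var 1))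
      (≈-trans (≈-sym (⟦⟧-⟪⟫ σ (var ∘ merge))) (≈-trans (⟪⟫-congˡ (≈-sym D≈σ) _) D-merge))
      (⟪⟫-congʳ (translate ιT t) λ { zero → ≈-refl ; (suc zero) → ≈-refl })

    D-collapsed : (σ : Separated T S) → U ⊢ D ≈ ⟦ σ ⟧ →
                  EqMod (eraseLeaves middle σ) (leafSep (s ⟨ var 0 , var 3 ⟩))
    D-collapsed σ D≈σ = uniqueness (eraseLeaves middle σ) (leafSep (s ⟨ var 0 , var 3 ⟩)) (sU (var 0) (var 3))
      (≈-trans (⟦eraseLeaves⟧ middle σ) (≈-trans (⟪⟫-congˡ (≈-sym D≈σ) _) D-collapse))
      (TrS.translate-⟨,⟩ s (var 0) (var 3))

theorem4p21 : (S T : Theory) →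
    -- (S1)
    (∀ (s' s'' : Term (sig S) ℕ) → ∅ ⊢ s' → S ⊢ s' ≈ s'' → ∅ ⊢ s'') →
    -- (S2)
    (∀ (s' : Term (sig S) ℕ) (x : ℕ) → S ⊢ s' ≈ var x → ｛ x ｝ ⊢ s') →
    -- (S4)
    (∀ (s' : Term (sig S) ℕ) → (∃ λ x → x ∈var s') →
      Σ (ℕ → Term (sig S) ℕ) λ f →
        ∀ x → x ∈var s' → S ⊢ substExcept x f s' ≈ var x) →
    -- (T2)
    (∀ (t' t'' : Term (sig T) ℕ) → ∅ ⊢ t' → T ⊢ t' ≈ t'' → ∅ ⊢ t'') →
    -- (T3)
    (∀ (t' : Term (sig T) ℕ) (x : ℕ) → T ⊢ t' ≈ var x → ｛ x ｝ ⊢ t') →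
    -- (T4)
    (Σ (Op (sig T)) λ eT → arity (sig T) eT ≡ 0) →
    (s : Term (sig S) (Fin 2)) (t : Term (sig T) (Fin 2)) →
    (es : Op (sig S)) (es0 : arity (sig S) es ≡ 0) →
    (et : Op (sig T)) (et0 : arity (sig T) et ≡ 0) →
    (∀ x → S ⊢ s ⟨ var x , const es es0 ⟩ ≈ var x) →
    (∀ x → S ⊢ s ⟨ const es es0 , var x ⟩ ≈ var x) →
    (∀ x → S ⊢ s ⟨ var x , var x ⟩ ≈ var x) →
    (∀ x → T ⊢ t ⟨ var x , const et et0 ⟩ ≈ var x) →
    (∀ x → T ⊢ t ⟨ const et et0 , var x ⟩ ≈ var x) →
    ¬ CompositeTheory T S
theorem4p21 S T S1 S2 S4 T2 T3 _ s t es es0 et et0 s-unitʳ s-unitˡ s-idem t-unitʳ t-unitˡ C =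
  uncurry inseparable (separation D)
  where
  open Composite C T2 S4 es es0 et et0
  open Diagonal s t s-idem t-unitʳ t-unitˡ

  inseparable : (σ : Separated T S) → U ⊢ D ≈ ⟦ σ ⟧ → ⊥
  inseparable σ D≈σ with EqMod-leaf⇒occurring-leaf≈ T2 T3 et0 (tT σ) (erasure middle (sS σ))
                           (erasure-erases middle (sS σ)) (sS σ) _ (D-collapsed σ D≈σ) (proj₁ (D-merged σ D≈σ))
  ... | j , j∈ , leaf≈s⟨x₀,x₃⟩ =
    [ unitˡ⇒≉x₀ S1 {w = s} (nullary-closed es0) (s-unitˡ 1) ∘ merged-leaf≈⇒s≈ ,
      unitʳ⇒≉x₁ S1 {w = s} (nullary-closed es0) (s-unitʳ 0) ∘ merged-leaf≈⇒s≈ ]′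
    (EqMod-binary⇒leaf≈x₀⊎x₁ S2 T3 {t = t} et0 t-unitʳ (substLeaves (var ∘ merge) σ) (D-merged σ D≈σ) j j∈)
    where
    merged-leaf≈⇒s≈ : ∀ {v} → S ⊢ sS σ j ⟪ var ∘ merge ⟫ ≈ v → S ⊢ s ⟨ var 0 , var 1 ⟩ ≈ v
    merged-leaf≈⇒s≈ leaf≈v =
      ≈-trans (≈-sym (⟨,⟩-⟪⟫ s _ _ _)) (≈-trans (⟪⟫-congˡ (≈-sym leaf≈s⟨x₀,x₃⟩) _) leaf≈v)
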